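{- For $n\ge1$ let $b(n,j)$ (resp. $\bar b(n,j)$) be the number of signed permutations in $\mathcal{B}_n$ with $j$ descents at odd positions and no descents (resp. no ascents) at even positions, so that $B_n(x,0)=\sum_{j=0}^{\lfloor n/2\rfloor}b(n,j)x^j$ and $\widehat{B}_n(x,0)=\sum_{j=0}^{\lfloor n/2\rfloor}\bar b(n,j)x^j$. Then $$\widetilde{B}_n(x,y)=\sum_{j=0}^{\lfloor n/2\rfloor}b(n,j)(x+y)^j(1+xy)^{\lfloor n/2\rfloor-j},\qquad \overline{B}_n(x,y)=\sum_{j=0}^{\lfloor n/2\rfloor}\bar b(n,j)(x+y)^j(1+xy)^{\lfloor n/2\rfloor-j}.$$
   Context: $\mathcal{B}_n$ is the set of signed permutations of $\{\pm1,\dots,\pm n\}$ ($\sigma(-i)=-\sigma(i)$), each identified with the word $\sigma(0)\sigma(1)\cdots\sigma(n)$ with $\sigma(0)=0$. A position $i\in\{0,\dots,n-1\}$ is a descent if $\sigma(i)>\sigma(i+1)$ and an ascent if $\sigma(i)<\sigma(i+1)$; "even positions" include $0$. $\mathrm{des}_1\sigma$ (resp. $\mathrm{des}_0\sigma$) counts descents at odd (resp. even) positions; $\mathrm{asc}_0\sigma$ counts ascents at even positions. $B_n(x,y)=\sum_{\sigma\in\mathcal{B}_n}x^{\mathrm{des}_1\sigma}y^{\mathrm{des}_0\sigma}$, $\widehat{B}_n(x,y)=\sum_{\sigma\in\mathcal{B}_n}x^{\mathrm{des}_1\sigma}y^{\mathrm{asc}_0\sigma}$. For $m\ge1$: $\widetilde{B}_{2m}=B_{2m}$,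 $\widetilde{B}_{2m-1}=(1+y)^{ -1}B_{2m-1}$, $\overline{B}_{2m}=\widehat{B}_{2m}$, $\overline{B}_{2m-1}=(1+y)^{ -1}\widehat{B}_{2m-1}$. -}

module Defs where

open import Data.Bool using (Bool; true; false; not; if_then_else_; _∧_)
open import Data.Nat using (ℕ; zero; suc; _∸_; _/_; _≡ᵇ_)
open import Data.Integer using (ℤ; +_; -_; ∣_∣; _+_; _*_; _^_; _<?_)
open import Data.List using (List; []; _∷_; map; _++_; filter; concatMap; length; upTo; foldr; sum)
open import Relation.Nullary.Decidable using (⌊_⌋)
open import Relation.Binary.PropositionalEquality using (_≡_)

signedVals : ℕ → List ℤ
signedVals n = map (λ i → + suc i) (upTo n) ++ map (λ i → - (+ suc i)) (upTo n)

words : {A : Set} → List A → ℕ → List (List A)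
words A zero = [] ∷ []
words A (suc k) = concatMap (λ a → map (a ∷_) (words A k)) A

elemᵇ : ℕ → List ℕ → Bool
elemᵇ a [] = false
elemᵇ a (b ∷ bs) = if a ≡ᵇ b then true else elemᵇ a bs

distinctᵇ : List ℕ → Bool
distinctᵇ [] = true
distinctᵇ (a ∷ as) = not (elemᵇ a as) ∧ distinctᵇ as

-- 𝓑ₙ: a signed permutation σ is recorded by its word σ(1)…σ(n) with entries
-- in {±1,…,±n} whose absolute values are pairwise distinct (σ(-i) = -σ(i)).
signedPerms : ℕ → List (List ℤ)
signedPerms n = filter (λ w → distinctᵇ (map ∣_∣ w) Data.Bool.≟ true) (words (signedVals n) n)

_>ᵇ_ : ℤ → ℤ → Bool
a >ᵇ b = ⌊ b <? a ⌋

_<ᵇ_ : ℤ → ℤ → Bool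
a <ᵇ b = ⌊ a <? b ⌋

countAlt : (ℤ → ℤ → Bool) → Bool → ℤ → List ℤ → ℕ
countAlt R c a [] = 0
countAlt R c a (b ∷ bs) =
  (if c ∧ R a b then 1 else 0) Data.Nat.+ countAlt R (not c) b bs

-- statistics on σ(0)σ(1)…σ(n) with σ(0) = 0; positions 0 … n-1
des₁ des₀ asc₀ : List ℤ → ℕ
des₁ w = countAlt _>ᵇ_ false (+ 0) w   -- descents at odd positions
des₀ w = countAlt _>ᵇ_ true (+ 0) w    -- descents at even positions (incl. 0)
asc₀ w = countAlt _<ᵇ_ true (+ 0) w    -- ascents at even positions (incl. 0)

sumℤ : List ℤ → ℤ
sumℤ = foldr _+_ (+ 0)

-- B_n(x,y) and \hat B_n(x,y), evaluated at integers x, y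
Bpoly : ℕ → ℤ → ℤ → ℤ
Bpoly n x y = sumℤ (map (λ σ → (x ^ des₁ σ) * (y ^ des₀ σ)) (signedPerms n))

Bhat : ℕ → ℤ → ℤ → ℤ
Bhat n x y = sumℤ (map (λ σ → (x ^ des₁ σ) * (y ^ asc₀ σ)) (signedPerms n))

bcoef : ℕ → ℕ → ℕ
bcoef n j = length (filter (λ σ → ((des₁ σ ≡ᵇ j) ∧ (des₀ σ ≡ᵇ 0)) Data.Bool.≟ true) (signedPerms n))

bbarcoef : ℕ → ℕ → ℕ
bbarcoef n j = length (filter (λ σ → ((des₁ σ ≡ᵇ j) ∧ (asc₀ σ ≡ᵇ 0)) Data.Bool.≟ true) (signedPerms n))

gammaSum : (ℕ → ℕ → ℕ) → ℕ → ℤ → ℤ → ℤ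
gammaSum c n x y =
  sumℤ (map (λ j → (+ c n j) * ((x + y) ^ j) * ((+ 1 + x * y) ^ (n / 2 ∸ j))) (upTo (suc (n / 2))))

{-# OPTIONS --safe #-}
-- Let Q(a) be the generating function of the injective signed words that may follow the
-- letter a, with descents at odd positions weighted by x and the even-position statistic
-- by y. Pairing a with -a, the one-letter recursion for Q becomes a recursion for the
-- pair sum Q(a) + Q(-a) and difference Q(a) - Q(-a) whose coefficients only involve
-- 1 ± x and 1 ± y. Since (1 + x)(1 + y) = (x + y) + (1 + xy) and
-- (1 - x)(1 - y) = (1 + xy) - (x + y), induction on the number of remaining letters shows
-- that both are gamma-expansions ∑ c_j (x + y)^j (1 + xy)^(h - j) up to explicit factors.
-- At a = σ(0) = 0 the pair sum is 2 B_n, and setting y = 0 identifies c_j as 2 b(n, j).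
module Submission where

open import Defs
open import Data.Bool using (Bool; true; false; not; if_then_else_; _∧_)
import Data.Bool as Bool
open import Data.Bool.Properties using (∧-zeroʳ; ∧-identityʳ)
open import Data.Empty using (⊥-elim)
open import Data.Integer using (ℤ; +_; -_; ∣_∣; _+_; _*_; _-_; _^_; +<+; _<?_)
import Data.Integer as ℤ
import Data.Integer.Properties as ℤₚ
open import Data.Integer.Tactic.RingSolver using (solve-∀)
open import Data.List using (List; []; _∷_; map; _++_; concatMap; filter; length; upTo)
open import Data.List.Properties using (map-upTo)
open import Data.List.Relation.Unary.All as All using (All; []; _∷_)
import Data.List.Relation.Unary.All.Properties as All
open import Data.Nat using (ℕ; zero; suc; z≤n; s≤s; _≤_; _∸_; _≡ᵇ_)
import Data.Nat as ℕ
import Data.Nat.Properties as ℕₚ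
open import Data.Nat.DivMod using (m/n≡1+[m∸n]/n)
open import Data.Product using (_×_; _,_; proj₁; proj₂)
open import Data.Sum using (_⊎_; inj₁; inj₂)
open import Function using (_∘_; mk⇔)
open import Relation.Binary using (tri<; tri≈; tri>)
open import Relation.Binary.PropositionalEquality
open import Relation.Nullary using (¬_)
open import Relation.Nullary.Decidable using (isYes≗does; dec-true; dec-false; does-⇔)

⟦_⟧ : Bool → ℤ
⟦ b ⟧ = if b then + 1 else + 0

guard : Bool → ℤ → ℤ
guard b t = if b then t else + 0

∑ : {A : Set} → (A → ℤ) → List A → ℤ
∑ f xs = sumℤ (map f xs)

module _ {A : Set} where

  ∑-cong-All : {f g : A → ℤ} {xs : List A} → All (λ a → f a ≡ g a) xs → ∑ f xs ≡ ∑ g xs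
  ∑-cong-All [] = refl
  ∑-cong-All (e ∷ es) = cong₂ _+_ e (∑-cong-All es)

  ∑-cong : {f g : A → ℤ} (xs : List A) → (∀ a → f a ≡ g a) → ∑ f xs ≡ ∑ g xs
  ∑-cong xs e = ∑-cong-All (All.universal e xs)

  ∑-zero : (xs : List A) → ∑ (λ _ → + 0) xs ≡ + 0
  ∑-zero [] = refl
  ∑-zero (a ∷ xs) = trans (ℤₚ.+-identityˡ _) (∑-zero xs)

  ∑-+ : (f g : A → ℤ) (xs : List A) → ∑ (λ a → f a + g a) xs ≡ ∑ f xs + ∑ g xs
  ∑-+ f g [] = refl
  ∑-+ f g (a ∷ xs) = trans (cong (_+_ (f a + g a)) (∑-+ f g xs)) (interchange (f a) (g a) _ _)
    where
    interchange : ∀ a b c d → (a + b) + (c + d) ≡ (a + c) + (b + d)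
    interchange = solve-∀

  ∑-minus : (f g : A → ℤ) (xs : List A) → ∑ (λ a → f a - g a) xs ≡ ∑ f xs - ∑ g xs
  ∑-minus f g [] = refl
  ∑-minus f g (a ∷ xs) = trans (cong (_+_ (f a - g a)) (∑-minus f g xs)) (interchange (f a) (g a) _ _)
    where
    interchange : ∀ a b c d → (a - b) + (c - d) ≡ (a + c) - (b + d)
    interchange = solve-∀

  ∑-*ˡ : (k : ℤ) (f : A → ℤ) (xs : List A) → ∑ (λ a → k * f a) xs ≡ k * ∑ f xs
  ∑-*ˡ k f [] = sym (ℤₚ.*-zeroʳ k)
  ∑-*ˡ k f (a ∷ xs) = trans (cong (_+_ (k * f a)) (∑-*ˡ k f xs)) (sym (ℤₚ.*-distribˡ-+ k (f a) _))

  ∑-++ : (f : A → ℤ) (xs ys : List A) → ∑ f (xs ++ ys) ≡ ∑ f xs + ∑ f ys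
  ∑-++ f [] ys = sym (ℤₚ.+-identityˡ _)
  ∑-++ f (a ∷ xs) ys = trans (cong (_+_ (f a)) (∑-++ f xs ys)) (sym (ℤₚ.+-assoc (f a) _ _))

  ∑-filter : (P : A → Bool) (f : A → ℤ) (xs : List A) →
    ∑ f (filter (λ a → P a Bool.≟ true) xs) ≡ ∑ (λ a → guard (P a) (f a)) xs
  ∑-filter P f [] = refl
  ∑-filter P f (a ∷ xs) with P a
  ... | true = cong (_+_ (f a)) (∑-filter P f xs)
  ... | false = trans (∑-filter P f xs) (sym (ℤₚ.+-identityˡ _))

  length-filter : (P : A → Bool) (xs : List A) →
    + length (filter (λ a → P a Bool.≟ true) xs) ≡ ∑ (λ a → ⟦ P a ⟧) xs
  length-filter P [] = refl
  length-filter P (a ∷ xs) with P a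
  ... | true = cong (_+_ (+ 1)) (length-filter P xs)
  ... | false = trans (length-filter P xs) (sym (ℤₚ.+-identityˡ _))

module _ {A B : Set} where

  ∑-map : (f : B → ℤ) (g : A → B) (xs : List A) → ∑ f (map g xs) ≡ ∑ (f ∘ g) xs
  ∑-map f g [] = refl
  ∑-map f g (a ∷ xs) = cong (_+_ (f (g a))) (∑-map f g xs)

  ∑-concatMap : (f : B → ℤ) (g : A → List B) (xs : List A) →
    ∑ f (concatMap g xs) ≡ ∑ (λ a → ∑ f (g a)) xs
  ∑-concatMap f g [] = refl
  ∑-concatMap f g (a ∷ xs) =
    trans (∑-++ f (g a) (concatMap g xs)) (cong (_+_ (∑ f (g a))) (∑-concatMap f g xs))

-- Gamma expansions

u v : ℤ → ℤ → ℤ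
u x y = x + y
v x y = + 1 + x * y

-- Γ h c = ∑_{j ≤ h} c j · u^j · v^(h - j), written as a Horner scheme in u.
Γ : ℕ → (ℕ → ℤ) → ℤ → ℤ → ℤ
Γ zero c x y = c 0
Γ (suc h) c x y = c 0 * v x y ^ suc h + u x y * Γ h (c ∘ suc) x y

Γ-explicit : ∀ h c x y →
  Γ h c x y ≡ ∑ (λ j → c j * u x y ^ j * v x y ^ (h ∸ j)) (upTo (suc h))
Γ-explicit zero c x y = unit-factor (c 0)
  where
  unit-factor : ∀ a → a ≡ a * + 1 * + 1 + + 0
  unit-factor = solve-∀
Γ-explicit (suc h) c x y = begin
  c 0 * v x y ^ suc h + u x y * Γ h (c ∘ suc) x y
    ≡⟨ cong (λ t → c 0 * v x y ^ suc h + u x y * t) (Γ-explicit h (c ∘ suc) x y) ⟩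
  c 0 * v x y ^ suc h + u x y * ∑ term (upTo (suc h))
    ≡⟨ cong₂ _+_ (unit-factor (c 0) (v x y ^ suc h)) (sym (∑-*ˡ (u x y) term (upTo (suc h)))) ⟩
  c 0 * + 1 * v x y ^ suc h + ∑ (λ j → u x y * term j) (upTo (suc h))
    ≡⟨ cong (_+_ (c 0 * + 1 * v x y ^ suc h)) (∑-cong (upTo (suc h)) absorb-u) ⟩
  c 0 * + 1 * v x y ^ suc h + ∑ (term′ ∘ suc) (upTo (suc h))
    ≡⟨ cong (_+_ (c 0 * + 1 * v x y ^ suc h))
         (trans (sym (∑-map term′ suc (upTo (suc h)))) (cong (∑ term′) (map-upTo suc (suc h)))) ⟩
  ∑ term′ (upTo (suc (suc h))) ∎
  where
  open ≡-Reasoning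
  term term′ : ℕ → ℤ
  term j = c (suc j) * u x y ^ j * v x y ^ (h ∸ j)
  term′ j = c j * u x y ^ j * v x y ^ (suc h ∸ j)
  unit-factor : ∀ a w → a * w ≡ a * + 1 * w
  unit-factor = solve-∀
  absorb-u : ∀ j → u x y * term j ≡ term′ (suc j)
  absorb-u j = reassoc (c (suc j)) (u x y) (u x y ^ j) (v x y ^ (h ∸ j))
    where
    reassoc : ∀ a w z t → w * (a * z * t) ≡ a * (w * z) * t
    reassoc = solve-∀

Γ-cong : ∀ h {c d} → (∀ j → j ≤ h → c j ≡ d j) → ∀ x y → Γ h c x y ≡ Γ h d x y
Γ-cong zero c≡d x y = c≡d 0 z≤n
Γ-cong (suc h) c≡d x y = cong₂ (λ a t → a * v x y ^ suc h + u x y * t)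
  (c≡d 0 z≤n) (Γ-cong h (λ j j≤h → c≡d (suc j) (s≤s j≤h)) x y)

Γ-zero : ∀ h x y → Γ h (λ _ → + 0) x y ≡ + 0
Γ-zero zero x y = refl
Γ-zero (suc h) x y = trans (cong (λ t → + 0 * v x y ^ suc h + u x y * t) (Γ-zero h x y)) (vanish (v x y ^ suc h) (u x y))
  where
  vanish : ∀ w z → + 0 * w + z * + 0 ≡ + 0
  vanish = solve-∀

Γ-+ : ∀ h c d x y → Γ h (λ j → c j + d j) x y ≡ Γ h c x y + Γ h d x y
Γ-+ zero c d x y = refl
Γ-+ (suc h) c d x y =
  trans (cong (λ t → (c 0 + d 0) * v x y ^ suc h + u x y * t) (Γ-+ h (c ∘ suc) (d ∘ suc) x y))
        (distrib (c 0) (d 0) (v x y ^ suc h) (u x y) _ _)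
  where
  distrib : ∀ a b w z s t → (a + b) * w + z * (s + t) ≡ (a * w + z * s) + (b * w + z * t)
  distrib = solve-∀

Γ-minus : ∀ h c d x y → Γ h (λ j → c j - d j) x y ≡ Γ h c x y - Γ h d x y
Γ-minus zero c d x y = refl
Γ-minus (suc h) c d x y =
  trans (cong (λ t → (c 0 - d 0) * v x y ^ suc h + u x y * t) (Γ-minus h (c ∘ suc) (d ∘ suc) x y))
        (distrib (c 0) (d 0) (v x y ^ suc h) (u x y) _ _)
  where
  distrib : ∀ a b w z s t → (a - b) * w + z * (s - t) ≡ (a * w + z * s) - (b * w + z * t)
  distrib = solve-∀

Γ-*ˡ : ∀ h k c x y → Γ h (λ j → k * c j) x y ≡ k * Γ h c x y
Γ-*ˡ zero k c x y = refl
Γ-*ˡ (suc h) k c x y =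
  trans (cong (λ t → k * c 0 * v x y ^ suc h + u x y * t) (Γ-*ˡ h k (c ∘ suc) x y))
        (distrib k (c 0) (v x y ^ suc h) (u x y) _)
  where
  distrib : ∀ k a w z s → k * a * w + z * (k * s) ≡ k * (a * w + z * s)
  distrib = solve-∀

shift : (ℕ → ℤ) → ℕ → ℤ
shift c zero = + 0
shift c (suc j) = c j

restrict : ℕ → (ℕ → ℤ) → ℕ → ℤ
restrict zero c zero = c 0
restrict zero c (suc j) = + 0
restrict (suc h) c zero = c 0
restrict (suc h) c (suc j) = restrict h (c ∘ suc) j

u*Γ : ∀ h c x y → u x y * Γ h c x y ≡ Γ (suc h) (shift c) x y
u*Γ h c x y = sym (ℤₚ.+-identityˡ _)

v*Γ : ∀ h c x y → v x y * Γ h c x y ≡ Γ (suc h) (restrict h c) x y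
v*Γ zero c x y = expand (c 0) (v x y) (u x y)
  where
  expand : ∀ a w z → w * a ≡ a * (w * + 1) + z * + 0
  expand = solve-∀
v*Γ (suc h) c x y =
  trans (distrib (c 0) (v x y) (v x y ^ suc h) (u x y) (Γ h (c ∘ suc) x y))
        (cong (λ t → c 0 * (v x y * v x y ^ suc h) + u x y * t) (v*Γ h (c ∘ suc) x y))
  where
  distrib : ∀ a w p z s → w * (a * p + z * s) ≡ a * (w * p) + z * (w * s)
  distrib = solve-∀

[u+v]*Γ : ∀ h c x y →
  (u x y + v x y) * Γ h c x y ≡ Γ (suc h) (λ j → shift c j + restrict h c j) x y
[u+v]*Γ h c x y = begin
  (u x y + v x y) * Γ h c x y                          ≡⟨ ℤₚ.*-distribʳ-+ (Γ h c x y) (u x y) (v x y) ⟩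
  u x y * Γ h c x y + v x y * Γ h c x y                ≡⟨ cong₂ _+_ (u*Γ h c x y) (v*Γ h c x y) ⟩
  Γ (suc h) (shift c) x y + Γ (suc h) (restrict h c) x y ≡⟨ Γ-+ (suc h) (shift c) (restrict h c) x y ⟨
  Γ (suc h) (λ j → shift c j + restrict h c j) x y     ∎
  where open ≡-Reasoning

[v-u]*Γ : ∀ h c x y →
  (v x y - u x y) * Γ h c x y ≡ Γ (suc h) (λ j → restrict h c j - shift c j) x y
[v-u]*Γ h c x y = begin
  (v x y - u x y) * Γ h c x y                            ≡⟨ distrib (v x y) (u x y) (Γ h c x y) ⟩
  v x y * Γ h c x y - u x y * Γ h c x y                  ≡⟨ cong₂ _-_ (v*Γ h c x y) (u*Γ h c x y) ⟩
  Γ (suc h) (restrict h c) x y - Γ (suc h) (shift c) x y ≡⟨ Γ-minus (suc h) (restrict h c) (shift c) x y ⟨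
  Γ (suc h) (λ j → restrict h c j - shift c j) x y       ∎
  where
  open ≡-Reasoning
  distrib : ∀ a b s → (a - b) * s ≡ a * s - b * s
  distrib = solve-∀

record HasGamma (m : ℤ → ℤ → ℤ) (h : ℕ) (F : ℤ → ℤ → ℤ) : Set where
  constructor hasGamma
  field
    coeff : ℕ → ℤ
    expand : ∀ x y → F x y ≡ m x y * Γ h coeff x y

open HasGamma

-- Degree h - 1, where degree -1 means F = 0.
HasGamma⁻ : (ℤ → ℤ → ℤ) → ℕ → (ℤ → ℤ → ℤ) → Set
HasGamma⁻ m zero F = ∀ x y → F x y ≡ + 0
HasGamma⁻ m (suc h) F = HasGamma m h F

module _ {m : ℤ → ℤ → ℤ} {h : ℕ} where

  HasGamma-resp : {F G : ℤ → ℤ → ℤ} → (∀ x y → F x y ≡ G x y) → HasGamma m h G → HasGamma m h F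
  HasGamma-resp F≡G (hasGamma c eq) = hasGamma c (λ x y → trans (F≡G x y) (eq x y))

  HasGamma-zero : {F : ℤ → ℤ → ℤ} → (∀ x y → F x y ≡ + 0) → HasGamma m h F
  HasGamma-zero F≡0 = hasGamma (λ _ → + 0) λ x y →
    trans (F≡0 x y) (sym (trans (cong (m x y *_) (Γ-zero h x y)) (ℤₚ.*-zeroʳ (m x y))))

  HasGamma-+ : {F G : ℤ → ℤ → ℤ} → HasGamma m h F → HasGamma m h G → HasGamma m h (λ x y → F x y + G x y)
  HasGamma-+ (hasGamma c eqF) (hasGamma d eqG) = hasGamma (λ j → c j + d j) λ x y → begin
    _                                   ≡⟨ cong₂ _+_ (eqF x y) (eqG x y) ⟩
    m x y * Γ h c x y + m x y * Γ h d x y ≡⟨ ℤₚ.*-distribˡ-+ (m x y) _ _ ⟨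
    m x y * (Γ h c x y + Γ h d x y)       ≡⟨ cong (m x y *_) (Γ-+ h c d x y) ⟨
    m x y * Γ h (λ j → c j + d j) x y     ∎
    where open ≡-Reasoning

  HasGamma-guard : {F : ℤ → ℤ → ℤ} (b : Bool) → HasGamma m h F → HasGamma m h (λ x y → guard b (F x y))
  HasGamma-guard true hasF = hasF
  HasGamma-guard false hasF = HasGamma-zero (λ x y → refl)

  HasGamma-∑ : {A : Set} (xs : List A) (F : A → ℤ → ℤ → ℤ) →
    (∀ a → HasGamma m h (F a)) → HasGamma m h (λ x y → ∑ (λ a → F a x y) xs)
  HasGamma-∑ [] F hasF = HasGamma-zero (λ x y → refl)
  HasGamma-∑ (a ∷ xs) F hasF = HasGamma-+ (hasF a) (HasGamma-∑ xs F hasF)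

HasGamma-* : ∀ {m h F} (G : ℤ → ℤ → ℤ) (h′ : ℕ) (T : (ℕ → ℤ) → ℕ → ℤ) →
  (∀ c x y → G x y * Γ h c x y ≡ Γ h′ (T c) x y) →
  (α m′ : ℤ → ℤ → ℤ) (κ : ℤ) → (∀ x y → α x y * m x y ≡ κ * (m′ x y * G x y)) →
  HasGamma m h F → HasGamma m′ h′ (λ x y → α x y * F x y)
HasGamma-* {m} {h} {F} G h′ T G*Γ α m′ κ factor (hasGamma c eq) = hasGamma (λ j → κ * T c j) λ x y → begin
  α x y * F x y                     ≡⟨ cong (α x y *_) (eq x y) ⟩
  α x y * (m x y * Γ h c x y)       ≡⟨ ℤₚ.*-assoc (α x y) _ _ ⟨
  α x y * m x y * Γ h c x y         ≡⟨ cong (_* Γ h c x y) (factor x y) ⟩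
  κ * (m′ x y * G x y) * Γ h c x y  ≡⟨ reassoc κ (m′ x y) (G x y) (Γ h c x y) ⟩
  m′ x y * (κ * (G x y * Γ h c x y)) ≡⟨ cong (λ t → m′ x y * (κ * t)) (G*Γ c x y) ⟩
  m′ x y * (κ * Γ h′ (T c) x y)      ≡⟨ cong (m′ x y *_) (Γ-*ˡ h′ κ (T c) x y) ⟨
  m′ x y * Γ h′ (λ j → κ * T c j) x y ∎
  where
  open ≡-Reasoning
  reassoc : ∀ k a b s → k * (a * b) * s ≡ a * (k * (b * s))
  reassoc = solve-∀

module _ {m : ℤ → ℤ → ℤ} {h : ℕ} {F : ℤ → ℤ → ℤ} (α m′ : ℤ → ℤ → ℤ) (κ : ℤ) where

  HasGamma-scale : (∀ x y → α x y * m x y ≡ κ * m′ x y) →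
    HasGamma m h F → HasGamma m′ h (λ x y → α x y * F x y)
  HasGamma-scale factor = HasGamma-* (λ _ _ → + 1) h (λ c → c) (λ c x y → ℤₚ.*-identityˡ _)
    α m′ κ (λ x y → trans (factor x y) (cong (κ *_) (sym (ℤₚ.*-identityʳ (m′ x y)))))

  HasGamma-[u+v] : (∀ x y → α x y * m x y ≡ κ * (m′ x y * (u x y + v x y))) →
    HasGamma m h F → HasGamma m′ (suc h) (λ x y → α x y * F x y)
  HasGamma-[u+v] = HasGamma-* (λ x y → u x y + v x y) (suc h) (λ c j → shift c j + restrict h c j) ([u+v]*Γ h) α m′ κ

  HasGamma-[v-u] : (∀ x y → α x y * m x y ≡ κ * (m′ x y * (v x y - u x y))) →
    HasGamma m h F → HasGamma m′ (suc h) (λ x y → α x y * F x y)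
  HasGamma-[v-u] = HasGamma-* (λ x y → v x y - u x y) (suc h) (λ c j → restrict h c j - shift c j) ([v-u]*Γ h) α m′ κ

HasGamma⁻-[v-u] : ∀ {m} h {F} (α m′ : ℤ → ℤ → ℤ) (κ : ℤ) →
  (∀ x y → α x y * m x y ≡ κ * (m′ x y * (v x y - u x y))) →
  HasGamma⁻ m h F → HasGamma m′ h (λ x y → α x y * F x y)
HasGamma⁻-[v-u] zero α m′ κ factor F≡0 =
  HasGamma-zero (λ x y → trans (cong (α x y *_) (F≡0 x y)) (ℤₚ.*-zeroʳ (α x y)))
HasGamma⁻-[v-u] (suc h) = HasGamma-[v-u]

-- Polynomials in one variable

Pol : ℕ → (ℕ → ℤ) → ℤ → ℤ
Pol zero a x = a 0
Pol (suc h) a x = a 0 + x * Pol h (a ∘ suc) x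

Γ-at-y≡0 : ∀ h c x → Γ h c x (+ 0) ≡ Pol h c x
Γ-at-y≡0 zero c x = refl
Γ-at-y≡0 (suc h) c x = begin
  c 0 * (+ 1 + x * + 0) ^ suc h + (x + + 0) * Γ h (c ∘ suc) x (+ 0)
    ≡⟨ cong₂ (λ w t → c 0 * w ^ suc h + (x + + 0) * t) (v-at-y≡0 x) (Γ-at-y≡0 h (c ∘ suc) x) ⟩
  c 0 * (+ 1) ^ suc h + (x + + 0) * Pol h (c ∘ suc) x
    ≡⟨ cong (λ w → c 0 * w + (x + + 0) * Pol h (c ∘ suc) x) (ℤₚ.^-zeroˡ (suc h)) ⟩
  c 0 * + 1 + (x + + 0) * Pol h (c ∘ suc) x
    ≡⟨ simplify (c 0) x _ ⟩
  c 0 + x * Pol h (c ∘ suc) x ∎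
  where
  open ≡-Reasoning
  v-at-y≡0 : ∀ x → + 1 + x * + 0 ≡ + 1
  v-at-y≡0 = solve-∀
  simplify : ∀ a x p → a * + 1 + (x + + 0) * p ≡ a + x * p
  simplify = solve-∀

Pol-cong : ∀ h {a b} → (∀ j → a j ≡ b j) → ∀ x → Pol h a x ≡ Pol h b x
Pol-cong zero a≗b x = a≗b 0
Pol-cong (suc h) a≗b x = cong₂ (λ s t → s + x * t) (a≗b 0) (Pol-cong h (a≗b ∘ suc) x)

Pol-zero : ∀ h x → Pol h (λ _ → + 0) x ≡ + 0
Pol-zero zero x = refl
Pol-zero (suc h) x = trans (cong (λ t → + 0 + x * t) (Pol-zero h x)) (trans (ℤₚ.+-identityˡ _) (ℤₚ.*-zeroʳ x))

Pol-+ : ∀ h a b x → Pol h (λ j → a j + b j) x ≡ Pol h a x + Pol h b x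
Pol-+ zero a b x = refl
Pol-+ (suc h) a b x =
  trans (cong (λ t → a 0 + b 0 + x * t) (Pol-+ h (a ∘ suc) (b ∘ suc) x)) (distrib (a 0) (b 0) x _ _)
  where
  distrib : ∀ a b x p q → a + b + x * (p + q) ≡ (a + x * p) + (b + x * q)
  distrib = solve-∀

Pol-minus : ∀ h a b x → Pol h (λ j → a j - b j) x ≡ Pol h a x - Pol h b x
Pol-minus zero a b x = refl
Pol-minus (suc h) a b x =
  trans (cong (λ t → a 0 - b 0 + x * t) (Pol-minus h (a ∘ suc) (b ∘ suc) x)) (distrib (a 0) (b 0) x _ _)
  where
  distrib : ∀ a b x p q → a - b + x * (p - q) ≡ (a + x * p) - (b + x * q)
  distrib = solve-∀

Pol-∑ : ∀ {A : Set} h (a : A → ℕ → ℤ) (xs : List A) x →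
  Pol h (λ j → ∑ (λ σ → a σ j) xs) x ≡ ∑ (λ σ → Pol h (a σ) x) xs
Pol-∑ h a [] x = Pol-zero h x
Pol-∑ h a (σ ∷ xs) x =
  trans (Pol-+ h (a σ) (λ j → ∑ (λ τ → a τ j) xs) x) (cong (_+_ (Pol h (a σ) x)) (Pol-∑ h a xs x))

Pol-indicator : ∀ h d (r : Bool) x → d ≤ h →
  Pol h (λ j → ⟦ (d ≡ᵇ j) ∧ r ⟧) x ≡ guard r (x ^ d)
Pol-indicator zero zero true x _ = refl
Pol-indicator zero zero false x _ = refl
Pol-indicator (suc h) zero r x _ =
  trans (cong (λ t → ⟦ r ⟧ + x * t) (Pol-zero h x))
        (trans (cong (_+_ ⟦ r ⟧) (ℤₚ.*-zeroʳ x)) (ℤₚ.+-identityʳ ⟦ r ⟧))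
Pol-indicator (suc h) (suc d) r x (s≤s d≤h) =
  trans (cong (λ t → + 0 + x * t) (Pol-indicator h d r x d≤h)) (times-x r)
  where
  times-x : ∀ r → + 0 + x * guard r (x ^ d) ≡ guard r (x * x ^ d)
  times-x true = ℤₚ.+-identityˡ _
  times-x false = trans (ℤₚ.+-identityˡ _) (ℤₚ.*-zeroʳ x)

coeffNorm : ℕ → (ℕ → ℤ) → ℕ
coeffNorm zero a = ∣ a 0 ∣
coeffNorm (suc h) a = ∣ a 0 ∣ ℕ.+ coeffNorm h (a ∘ suc)

∣coeff∣≤coeffNorm : ∀ h a j → j ≤ h → ∣ a j ∣ ≤ coeffNorm h a
∣coeff∣≤coeffNorm zero a zero _ = ℕₚ.≤-refl
∣coeff∣≤coeffNorm (suc h) a zero _ = ℕₚ.m≤m+n _ _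
∣coeff∣≤coeffNorm (suc h) a (suc j) (s≤s j≤h) =
  ℕₚ.≤-trans (∣coeff∣≤coeffNorm h (a ∘ suc) j j≤h) (ℕₚ.m≤n+m _ _)

-- At a point M exceeding every |a j|, the coefficients are the base-M digits of the value.
Pol-root⇒coeff≡0 : ∀ h a M → (∀ j → j ≤ h → ∣ a j ∣ ℕ.< M) →
  Pol h a (+ M) ≡ + 0 → ∀ j → j ≤ h → a j ≡ + 0
Pol-root⇒coeff≡0 zero a M bound root zero _ = root
Pol-root⇒coeff≡0 (suc h) a M bound root = coeff≡0
  where
  q : ℤ
  q = Pol h (a ∘ suc) (+ M)
  a₀≡-Mq : a 0 ≡ - (+ M * q)
  a₀≡-Mq = trans (cancel (a 0) (+ M * q)) (trans (cong (_- (+ M * q)) root) (ℤₚ.+-identityˡ _))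
    where
    cancel : ∀ a t → a ≡ (a + t) - t
    cancel = solve-∀
  ∣a₀∣≡M*∣q∣ : ∣ a 0 ∣ ≡ M ℕ.* ∣ q ∣
  ∣a₀∣≡M*∣q∣ = trans (cong ∣_∣ a₀≡-Mq) (trans (ℤₚ.∣-i∣≡∣i∣ (+ M * q)) (ℤₚ.abs-* (+ M) q))
  ∣q∣≡0 : ∣ q ∣ ≡ 0
  ∣q∣≡0 with ∣ q ∣ | ∣a₀∣≡M*∣q∣
  ... | zero | _ = refl
  ... | suc k | ∣a₀∣≡ = ⊥-elim (ℕₚ.<⇒≱ (bound 0 z≤n) (subst (M ℕ.≤_) (sym ∣a₀∣≡) (ℕₚ.m≤m*n M (suc k))))
  q≡0 : q ≡ + 0
  q≡0 = ℤₚ.∣i∣≡0⇒i≡0 ∣q∣≡0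
  coeff≡0 : ∀ j → j ≤ suc h → a j ≡ + 0
  coeff≡0 zero _ = trans a₀≡-Mq (trans (cong (λ t → - (+ M * t)) q≡0) (cong -_ (ℤₚ.*-zeroʳ (+ M))))
  coeff≡0 (suc j) (s≤s j≤h) =
    Pol-root⇒coeff≡0 h (a ∘ suc) M (λ i i≤h → bound (suc i) (s≤s i≤h)) q≡0 j j≤h

Pol-injective : ∀ h a b → (∀ x → Pol h a x ≡ Pol h b x) → ∀ j → j ≤ h → a j ≡ b j
Pol-injective h a b a≗b j j≤h =
  ℤₚ.i-j≡0⇒i≡j (a j) (b j) (Pol-root⇒coeff≡0 h d M bound root j j≤h)
  where
  d : ℕ → ℤ
  d j = a j - b j
  M : ℕ
  M = suc (coeffNorm h d)
  bound : ∀ i → i ≤ h → ∣ d i ∣ ℕ.< M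
  bound i i≤h = s≤s (∣coeff∣≤coeffNorm h d i i≤h)
  root : Pol h d (+ M) ≡ + 0
  root = trans (Pol-minus h a b (+ M)) (trans (cong (_- Pol h b (+ M)) (a≗b (+ M))) (ℤₚ.+-inverseʳ (Pol h b (+ M))))

Γ-coeff-from-y≡0 : ∀ h (F m : ℤ → ℤ → ℤ) (b c : ℕ → ℤ) →
  (∀ x → m x (+ 0) ≡ + 1) → (∀ x → F x (+ 0) ≡ Pol h b x) →
  (∀ x y → F x y + F x y ≡ m x y * Γ h c x y) →
  ∀ x y → F x y ≡ m x y * Γ h b x y
Γ-coeff-from-y≡0 h F m b c m₀≡1 F₀≡Pol 2F≡mΓ x y = ℤₚ.*-cancelˡ-≡ (+ 2) _ _ (begin
  + 2 * F x y                             ≡⟨ double (F x y) ⟩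
  F x y + F x y                           ≡⟨ 2F≡mΓ x y ⟩
  m x y * Γ h c x y                       ≡⟨ cong (m x y *_) (Γ-cong h c≡b+b x y) ⟩
  m x y * Γ h (λ j → b j + b j) x y       ≡⟨ cong (m x y *_) (Γ-+ h b b x y) ⟩
  m x y * (Γ h b x y + Γ h b x y)         ≡⟨ double-distrib (m x y) (Γ h b x y) ⟩
  + 2 * (m x y * Γ h b x y)               ∎)
  where
  open ≡-Reasoning
  double : ∀ a → + 2 * a ≡ a + a
  double = solve-∀
  double-distrib : ∀ a t → a * (t + t) ≡ + 2 * (a * t)
  double-distrib = solve-∀
  c≗b+b : ∀ x → Pol h c x ≡ Pol h (λ j → b j + b j) x
  c≗b+b x = begin
    Pol h c x                    ≡⟨ Γ-at-y≡0 h c x ⟨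
    Γ h c x (+ 0)                ≡⟨ ℤₚ.*-identityˡ _ ⟨
    + 1 * Γ h c x (+ 0)          ≡⟨ cong (_* Γ h c x (+ 0)) (m₀≡1 x) ⟨
    m x (+ 0) * Γ h c x (+ 0)    ≡⟨ 2F≡mΓ x (+ 0) ⟨
    F x (+ 0) + F x (+ 0)        ≡⟨ cong₂ _+_ (F₀≡Pol x) (F₀≡Pol x) ⟩
    Pol h b x + Pol h b x        ≡⟨ Pol-+ h b b x ⟨
    Pol h (λ j → b j + b j) x    ∎
  c≡b+b : ∀ j → j ≤ h → c j ≡ b j + b j
  c≡b+b = Pol-injective h c (λ j → b j + b j) c≗b+b

<ᵇ-true : ∀ {a b} → a ℤ.< b → (a <ᵇ b) ≡ true
<ᵇ-true {a} {b} a<b = trans (isYes≗does (a <? b)) (dec-true (a <? b) a<b)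

<ᵇ-false : ∀ {a b} → ¬ a ℤ.< b → (a <ᵇ b) ≡ false
<ᵇ-false {a} {b} a≮b = trans (isYes≗does (a <? b)) (dec-false (a <? b) a≮b)

<ᵇ-flip : ∀ {a b} → a ≢ b → (b <ᵇ a) ≡ not (a <ᵇ b)
<ᵇ-flip {a} {b} a≢b with ℤₚ.<-cmp a b
... | tri< a<b _ b≮a = trans (<ᵇ-false b≮a) (cong not (sym (<ᵇ-true a<b)))
... | tri≈ _ a≡b _ = ⊥-elim (a≢b a≡b)
... | tri> a≮b _ b<a = trans (<ᵇ-true b<a) (cong not (sym (<ᵇ-false a≮b)))

-<ᵇ- : ∀ a b → ((- a) <ᵇ (- b)) ≡ (b <ᵇ a)
-<ᵇ- a b = trans (isYes≗does (- a <? - b))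
  (trans (does-⇔ (mk⇔ ℤₚ.neg-cancel-< ℤₚ.neg-mono-<) (- a <? - b) (b <? a)) (sym (isYes≗does (b <? a))))

-ℕ<ᵇsuc : ∀ p i → ((- (+ p)) <ᵇ (+ suc i)) ≡ true
-ℕ<ᵇsuc zero i = <ᵇ-true {+ 0} {+ suc i} (+<+ (s≤s z≤n))
-ℕ<ᵇsuc (suc p) i = refl

suc<ᵇ-ℕ : ∀ p i → ((+ suc i) <ᵇ (- (+ p))) ≡ false
suc<ᵇ-ℕ zero i = <ᵇ-false {+ suc i} {+ 0} (λ { (+<+ ()) })
suc<ᵇ-ℕ (suc p) i = refl

weight : (ℤ → ℤ → Bool) → ℤ → ℤ → ℤ → ℤ
weight R z a b = if R a b then z else + 1

-- Transitions out of +p and out of -p; fp and fm weight the continuations after +(suc i) and -(suc i).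
module _ (R : ℤ → ℤ → Bool) (z : ℤ) (p i : ℕ) (fp fm : ℤ) where

  fromPlus fromMinus : ℤ
  fromPlus = weight R z (+ p) (+ suc i) * fp + weight R z (+ p) (- (+ suc i)) * fm
  fromMinus = weight R z (- (+ p)) (+ suc i) * fp + weight R z (- (+ p)) (- (+ suc i)) * fm

PairSum PairDiff : (ℤ → ℤ → Bool) → ℤ → Set
PairSum R e = ∀ z p i fp fm → p ≢ suc i →
  fromPlus R z p i fp fm + fromMinus R z p i fp fm
    ≡ (+ 1 + z) * (fp + fm) + e * (+ 1 - z) * ⟦ not ((+ suc i) <ᵇ (+ p)) ⟧ * (fp - fm)
PairDiff R e = ∀ z p i fp fm → p ≢ suc i →
  fromPlus R z p i fp fm - fromMinus R z p i fp fm
    ≡ - e * (+ 1 - z) * ⟦ (+ suc i) <ᵇ (+ p) ⟧ * (fp + fm)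

module _ {p i : ℕ} (p≢q : p ≢ suc i) where

  +p<ᵇ+q : ((+ p) <ᵇ (+ suc i)) ≡ not ((+ suc i) <ᵇ (+ p))
  +p<ᵇ+q = <ᵇ-flip (p≢q ∘ sym ∘ ℤₚ.+-injective)

  -q<ᵇ-p : ((- (+ suc i)) <ᵇ (- (+ p))) ≡ not ((+ suc i) <ᵇ (+ p))
  -q<ᵇ-p = trans (-<ᵇ- (+ suc i) (+ p)) +p<ᵇ+q

module _ (z : ℤ) (p i : ℕ) (fp fm : ℤ) where

  private
    W : Bool → ℤ
    W b = if b then z else + 1
    β : Bool
    β = (+ suc i) <ᵇ (+ p)

  fromMinus-descent : p ≢ suc i → fromMinus _>ᵇ_ z p i fp fm ≡ + 1 * fp + W (not β) * fm
  fromMinus-descent p≢q = cong₂ (λ s t → W s * fp + W t * fm) (suc<ᵇ-ℕ p i) (-q<ᵇ-p p≢q)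

  fromPlus-ascent : p ≢ suc i → fromPlus _<ᵇ_ z p i fp fm ≡ W (not β) * fp + + 1 * fm
  fromPlus-ascent p≢q = cong (λ s → W s * fp + + 1 * fm) (+p<ᵇ+q p≢q)

  fromMinus-ascent : fromMinus _<ᵇ_ z p i fp fm ≡ z * fp + W β * fm
  fromMinus-ascent = cong₂ (λ s t → W s * fp + W t * fm) (-ℕ<ᵇsuc p i) (-<ᵇ- (+ p) (+ suc i))

  pairSum-descent : p ≢ suc i → fromPlus _>ᵇ_ z p i fp fm + fromMinus _>ᵇ_ z p i fp fm
    ≡ (+ 1 + z) * (fp + fm) + + 1 * (+ 1 - z) * ⟦ not β ⟧ * (fp - fm)
  pairSum-descent p≢q = trans (cong (_+_ (W β * fp + z * fm)) (fromMinus-descent p≢q)) (closed β)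
    where
    closed : ∀ β → (W β * fp + z * fm) + (+ 1 * fp + W (not β) * fm)
      ≡ (+ 1 + z) * (fp + fm) + + 1 * (+ 1 - z) * ⟦ not β ⟧ * (fp - fm)
    closed true = q<p z fp fm
      where
      q<p : ∀ z fp fm → (z * fp + z * fm) + (+ 1 * fp + + 1 * fm)
        ≡ (+ 1 + z) * (fp + fm) + + 1 * (+ 1 - z) * + 0 * (fp - fm)
      q<p = solve-∀
    closed false = p<q z fp fm
      where
      p<q : ∀ z fp fm → (+ 1 * fp + z * fm) + (+ 1 * fp + z * fm)
        ≡ (+ 1 + z) * (fp + fm) + + 1 * (+ 1 - z) * + 1 * (fp - fm)
      p<q = solve-∀

  pairDiff-descent : p ≢ suc i → fromPlus _>ᵇ_ z p i fp fm - fromMinus _>ᵇ_ z p i fp fm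
    ≡ - (+ 1) * (+ 1 - z) * ⟦ β ⟧ * (fp + fm)
  pairDiff-descent p≢q = trans (cong (_-_ (W β * fp + z * fm)) (fromMinus-descent p≢q)) (closed β)
    where
    closed : ∀ β → (W β * fp + z * fm) - (+ 1 * fp + W (not β) * fm)
      ≡ - (+ 1) * (+ 1 - z) * ⟦ β ⟧ * (fp + fm)
    closed true = q<p z fp fm
      where
      q<p : ∀ z fp fm → (z * fp + z * fm) - (+ 1 * fp + + 1 * fm) ≡ - (+ 1) * (+ 1 - z) * + 1 * (fp + fm)
      q<p = solve-∀
    closed false = p<q z fp fm
      where
      p<q : ∀ z fp fm → (+ 1 * fp + z * fm) - (+ 1 * fp + z * fm) ≡ - (+ 1) * (+ 1 - z) * + 0 * (fp + fm)
      p<q = solve-∀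

  pairSum-ascent : p ≢ suc i → fromPlus _<ᵇ_ z p i fp fm + fromMinus _<ᵇ_ z p i fp fm
    ≡ (+ 1 + z) * (fp + fm) + - (+ 1) * (+ 1 - z) * ⟦ not β ⟧ * (fp - fm)
  pairSum-ascent p≢q = trans (cong₂ _+_ (fromPlus-ascent p≢q) fromMinus-ascent) (closed β)
    where
    closed : ∀ β → (W (not β) * fp + + 1 * fm) + (z * fp + W β * fm)
      ≡ (+ 1 + z) * (fp + fm) + - (+ 1) * (+ 1 - z) * ⟦ not β ⟧ * (fp - fm)
    closed true = q<p z fp fm
      where
      q<p : ∀ z fp fm → (+ 1 * fp + + 1 * fm) + (z * fp + z * fm)
        ≡ (+ 1 + z) * (fp + fm) + - (+ 1) * (+ 1 - z) * + 0 * (fp - fm)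
      q<p = solve-∀
    closed false = p<q z fp fm
      where
      p<q : ∀ z fp fm → (z * fp + + 1 * fm) + (z * fp + + 1 * fm)
        ≡ (+ 1 + z) * (fp + fm) + - (+ 1) * (+ 1 - z) * + 1 * (fp - fm)
      p<q = solve-∀

  pairDiff-ascent : p ≢ suc i → fromPlus _<ᵇ_ z p i fp fm - fromMinus _<ᵇ_ z p i fp fm
    ≡ - - (+ 1) * (+ 1 - z) * ⟦ β ⟧ * (fp + fm)
  pairDiff-ascent p≢q = trans (cong₂ _-_ (fromPlus-ascent p≢q) fromMinus-ascent) (closed β)
    where
    closed : ∀ β → (W (not β) * fp + + 1 * fm) - (z * fp + W β * fm)
      ≡ - - (+ 1) * (+ 1 - z) * ⟦ β ⟧ * (fp + fm)
    closed true = q<p z fp fm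
      where
      q<p : ∀ z fp fm → (+ 1 * fp + + 1 * fm) - (z * fp + z * fm) ≡ - - (+ 1) * (+ 1 - z) * + 1 * (fp + fm)
      q<p = solve-∀
    closed false = p<q z fp fm
      where
      p<q : ∀ z fp fm → (z * fp + + 1 * fm) - (z * fp + + 1 * fm) ≡ - - (+ 1) * (+ 1 - z) * + 0 * (fp + fm)
      p<q = solve-∀

-- Weighted signed words

≡ᵇ-sym : ∀ a b → (a ≡ᵇ b) ≡ (b ≡ᵇ a)
≡ᵇ-sym zero zero = refl
≡ᵇ-sym zero (suc b) = refl
≡ᵇ-sym (suc a) zero = refl
≡ᵇ-sym (suc a) (suc b) = ≡ᵇ-sym a b

≡ᵇ-refl : ∀ a → (a ≡ᵇ a) ≡ true
≡ᵇ-refl zero = refl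
≡ᵇ-refl (suc a) = ≡ᵇ-refl a

disjointᵇ : List ℕ → List ℕ → Bool
disjointᵇ [] U = true
disjointᵇ (b ∷ bs) U = not (elemᵇ b U) ∧ disjointᵇ bs U

disjointᵇ-[] : ∀ bs → disjointᵇ bs [] ≡ true
disjointᵇ-[] [] = refl
disjointᵇ-[] (b ∷ bs) = disjointᵇ-[] bs

disjointᵇ-∷ʳ : ∀ bs a U → disjointᵇ bs (a ∷ U) ≡ not (elemᵇ a bs) ∧ disjointᵇ bs U
disjointᵇ-∷ʳ [] a U = refl
disjointᵇ-∷ʳ (b ∷ bs) a U rewrite disjointᵇ-∷ʳ bs a U | ≡ᵇ-sym b a =
  reorder (a ≡ᵇ b) (elemᵇ a bs) (elemᵇ b U) (disjointᵇ bs U)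
  where
  reorder : ∀ e p q r →
    not (if e then true else q) ∧ (not p ∧ r) ≡ not (if e then true else p) ∧ (not q ∧ r)
  reorder true p q r = refl
  reorder false false false r = refl
  reorder false false true r = refl
  reorder false true false r = refl
  reorder false true true r = refl

freshᵇ : List ℕ → List ℤ → Bool
freshᵇ U w = distinctᵇ (map ∣_∣ w) ∧ disjointᵇ (map ∣_∣ w) U

freshᵇ-∷ : ∀ U b w → freshᵇ U (b ∷ w) ≡ not (elemᵇ ∣ b ∣ U) ∧ freshᵇ (∣ b ∣ ∷ U) w
freshᵇ-∷ U b w rewrite disjointᵇ-∷ʳ (map ∣_∣ w) ∣ b ∣ U =
  reorder (elemᵇ ∣ b ∣ (map ∣_∣ w)) (distinctᵇ (map ∣_∣ w)) (elemᵇ ∣ b ∣ U) (disjointᵇ (map ∣_∣ w) U)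
  where
  reorder : ∀ p q r s → (not p ∧ q) ∧ (not r ∧ s) ≡ not r ∧ (q ∧ (not p ∧ s))
  reorder false q false s = refl
  reorder false q true s = ∧-zeroʳ q
  reorder true q false s = sym (∧-zeroʳ q)
  reorder true q true s = refl

^-if : ∀ (r : Bool) z m → z ^ ((if r then 1 else 0) ℕ.+ m) ≡ (if r then z else + 1) * z ^ m
^-if true z m = refl
^-if false z m = sym (ℤₚ.*-identityˡ _)

module Words (R₀ : ℤ → ℤ → Bool) (n : ℕ) where

  -- The flag c records the parity of the next position: at even positions (c = true) the
  -- statistic R₀ is weighted by y, at odd positions descents are weighted by x.
  comparison : Bool → ℤ → ℤ → Bool
  comparison true = R₀
  comparison false = _>ᵇ_

  variable-at : Bool → ℤ → ℤ → ℤ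
  variable-at true x y = y
  variable-at false x y = x

  stepWeight : Bool → ℤ → ℤ → ℤ → ℤ → ℤ
  stepWeight c a b x y = weight (comparison c) (variable-at c x y) a b

  wordWeight : Bool → ℤ → List ℤ → ℤ → ℤ → ℤ
  wordWeight c a [] x y = + 1
  wordWeight c a (b ∷ w) x y = stepWeight c a b x y * wordWeight (not c) b w x y

  monomial≡wordWeight : ∀ c a w x y →
    x ^ countAlt _>ᵇ_ (not c) a w * y ^ countAlt R₀ c a w ≡ wordWeight c a w x y
  monomial≡wordWeight c a [] x y = refl
  monomial≡wordWeight true a (b ∷ w) x y = begin
    x ^ countAlt _>ᵇ_ true b w * y ^ ((if R₀ a b then 1 else 0) ℕ.+ countAlt R₀ false b w)
      ≡⟨ cong (x ^ countAlt _>ᵇ_ true b w *_) (^-if (R₀ a b) y _) ⟩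
    x ^ countAlt _>ᵇ_ true b w * (weight R₀ y a b * y ^ countAlt R₀ false b w)
      ≡⟨ swap (x ^ countAlt _>ᵇ_ true b w) (weight R₀ y a b) _ ⟩
    weight R₀ y a b * (x ^ countAlt _>ᵇ_ true b w * y ^ countAlt R₀ false b w)
      ≡⟨ cong (weight R₀ y a b *_) (monomial≡wordWeight false b w x y) ⟩
    weight R₀ y a b * wordWeight false b w x y ∎
    where
    open ≡-Reasoning
    swap : ∀ s r t → s * (r * t) ≡ r * (s * t)
    swap = solve-∀
  monomial≡wordWeight false a (b ∷ w) x y = begin
    x ^ ((if a >ᵇ b then 1 else 0) ℕ.+ countAlt _>ᵇ_ false b w) * y ^ countAlt R₀ true b w
      ≡⟨ cong (_* y ^ countAlt R₀ true b w) (^-if (a >ᵇ b) x _) ⟩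
    weight _>ᵇ_ x a b * x ^ countAlt _>ᵇ_ false b w * y ^ countAlt R₀ true b w
      ≡⟨ ℤₚ.*-assoc (weight _>ᵇ_ x a b) _ _ ⟩
    weight _>ᵇ_ x a b * (x ^ countAlt _>ᵇ_ false b w * y ^ countAlt R₀ true b w)
      ≡⟨ cong (weight _>ᵇ_ x a b *_) (monomial≡wordWeight true b w x y) ⟩
    weight _>ᵇ_ x a b * wordWeight true b w x y ∎
    where open ≡-Reasoning

  Q : Bool → ℤ → List ℕ → ℕ → ℤ → ℤ → ℤ
  Q c a U k x y = ∑ (λ w → guard (freshᵇ U w) (wordWeight c a w x y)) (words (signedVals n) k)

  extend : Bool → ℤ → List ℕ → ℕ → ℤ → ℤ → ℤ → ℤ
  extend c a U k b x y = stepWeight c a b x y * Q (not c) b (∣ b ∣ ∷ U) k x y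

  available : List ℕ → ℕ → Bool
  available U i = not (elemᵇ (suc i) U)

  Q-step : ∀ c a U k x y → Q c a U (suc k) x y ≡
    ∑ (λ i → guard (available U i) (extend c a U k (+ suc i) x y)) (upTo n)
    + ∑ (λ i → guard (available U i) (extend c a U k (- (+ suc i)) x y)) (upTo n)
  Q-step c a U k x y = begin
    ∑ summand (concatMap (λ b → map (b ∷_) ws) (signedVals n))
      ≡⟨ ∑-concatMap summand (λ b → map (b ∷_) ws) (signedVals n) ⟩
    ∑ (λ b → ∑ summand (map (b ∷_) ws)) (signedVals n)
      ≡⟨ ∑-cong (signedVals n) first-letter ⟩
    ∑ byFirst (map (λ i → + suc i) (upTo n) ++ map (λ i → - (+ suc i)) (upTo n))
      ≡⟨ ∑-++ byFirst (map (λ i → + suc i) (upTo n)) (map (λ i → - (+ suc i)) (upTo n)) ⟩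
    ∑ byFirst (map (λ i → + suc i) (upTo n)) + ∑ byFirst (map (λ i → - (+ suc i)) (upTo n))
      ≡⟨ cong₂ _+_ (∑-map byFirst (λ i → + suc i) (upTo n)) (∑-map byFirst (λ i → - (+ suc i)) (upTo n)) ⟩
    _ ∎
    where
    open ≡-Reasoning
    ws : List (List ℤ)
    ws = words (signedVals n) k
    summand : List ℤ → ℤ
    summand w = guard (freshᵇ U w) (wordWeight c a w x y)
    byFirst : ℤ → ℤ
    byFirst b = guard (not (elemᵇ ∣ b ∣ U)) (extend c a U k b x y)
    first-letter : ∀ b → ∑ summand (map (b ∷_) ws) ≡ byFirst b
    first-letter b =
      trans (∑-map summand (b ∷_) ws)
            (trans (∑-cong ws (λ w → cong (λ t → guard t (wordWeight c a (b ∷ w) x y)) (freshᵇ-∷ U b w)))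
                   (pull-out (not (elemᵇ ∣ b ∣ U))))
      where
      factor : ∀ w → guard (freshᵇ (∣ b ∣ ∷ U) w) (wordWeight c a (b ∷ w) x y)
        ≡ stepWeight c a b x y * guard (freshᵇ (∣ b ∣ ∷ U) w) (wordWeight (not c) b w x y)
      factor w with freshᵇ (∣ b ∣ ∷ U) w
      ... | true = refl
      ... | false = sym (ℤₚ.*-zeroʳ (stepWeight c a b x y))
      pull-out : ∀ e → ∑ (λ w → guard (e ∧ freshᵇ (∣ b ∣ ∷ U) w) (wordWeight c a (b ∷ w) x y)) ws
        ≡ guard e (extend c a U k b x y)
      pull-out false = ∑-zero ws
      pull-out true = trans (∑-cong ws factor) (∑-*ˡ (stepWeight c a b x y) _ ws)

-- Gamma expansions of the pair sums and differences

double : ℕ → ℕ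
double zero = zero
double (suc h) = suc (suc (double h))

module GammaInvariants (R₀ : ℤ → ℤ → Bool) (e₀ : ℤ)
  (pairSum₀ : PairSum R₀ e₀) (pairDiff₀ : PairDiff R₀ e₀) (n : ℕ) where

  open Words R₀ n public

  sign : Bool → ℤ
  sign true = e₀
  sign false = + 1

  pairSum : ∀ c → PairSum (comparison c) (sign c)
  pairSum true = pairSum₀
  pairSum false = pairSum-descent

  pairDiff : ∀ c → PairDiff (comparison c) (sign c)
  pairDiff true = pairDiff₀
  pairDiff false = pairDiff-descent

  Q₊ Q₋ : Bool → ℕ → List ℕ → ℕ → ℤ → ℤ → ℤ
  Q₊ c p U k x y = Q c (+ p) U k x y + Q c (- (+ p)) U k x y
  Q₋ c p U k x y = Q c (+ p) U k x y - Q c (- (+ p)) U k x y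

  -- p = 0 stands for the letter σ(0) = 0.
  Used : List ℕ → ℕ → Set
  Used U p = p ≡ 0 ⊎ elemᵇ p U ≡ true

  Used⇒≢ : ∀ {U p i} → Used U p → available U i ≡ true → p ≢ suc i
  Used⇒≢ (inj₁ refl) _ ()
  Used⇒≢ (inj₂ p∈U) avail refl with () ← trans (sym (cong not p∈U)) avail

  Used-new : ∀ i U → Used (suc i ∷ U) (suc i)
  Used-new i U rewrite ≡ᵇ-refl i = inj₂ refl

  below : ℕ → ℕ → Bool
  below p i = (+ suc i) <ᵇ (+ p)

  Q₊-summand Q₋-summand : Bool → ℕ → List ℕ → ℕ → ℕ → ℤ → ℤ → ℤ
  Q₊-summand c p U k i x y = (+ 1 + variable-at c x y) * Q₊ (not c) (suc i) (suc i ∷ U) k x y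
    + sign c * (+ 1 - variable-at c x y) * ⟦ not (below p i) ⟧ * Q₋ (not c) (suc i) (suc i ∷ U) k x y
  Q₋-summand c p U k i x y =
    - sign c * (+ 1 - variable-at c x y) * ⟦ below p i ⟧ * Q₊ (not c) (suc i) (suc i ∷ U) k x y

  Q₊-step : ∀ c p U k → Used U p → ∀ x y →
    Q₊ c p U (suc k) x y ≡ ∑ (λ i → guard (available U i) (Q₊-summand c p U k i x y)) (upTo n)
  Q₊-step c p U k used x y = begin
    Q₊ c p U (suc k) x y
      ≡⟨ cong₂ _+_ (Q-step c (+ p) U k x y) (Q-step c (- (+ p)) U k x y) ⟩
    (∑ _ (upTo n) + ∑ _ (upTo n)) + (∑ _ (upTo n) + ∑ _ (upTo n))
      ≡⟨ cong₂ _+_ (∑-+ _ _ (upTo n)) (∑-+ _ _ (upTo n)) ⟨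
    ∑ _ (upTo n) + ∑ _ (upTo n)
      ≡⟨ ∑-+ _ _ (upTo n) ⟨
    ∑ _ (upTo n)
      ≡⟨ ∑-cong (upTo n) (λ i → paired i (available U i) (Used⇒≢ {U} used)) ⟩
    ∑ (λ i → guard (available U i) (Q₊-summand c p U k i x y)) (upTo n) ∎
    where
    open ≡-Reasoning
    paired : ∀ i (avail : Bool) → (avail ≡ true → p ≢ suc i) →
      (guard avail (extend c (+ p) U k (+ suc i) x y) + guard avail (extend c (+ p) U k (- (+ suc i)) x y))
        + (guard avail (extend c (- (+ p)) U k (+ suc i) x y) + guard avail (extend c (- (+ p)) U k (- (+ suc i)) x y))
      ≡ guard avail (Q₊-summand c p U k i x y)
    paired i true p≢q = pairSum c (variable-at c x y) p i _ _ (p≢q refl)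
    paired i false p≢q = refl

  Q₋-step : ∀ c p U k → Used U p → ∀ x y →
    Q₋ c p U (suc k) x y ≡ ∑ (λ i → guard (available U i) (Q₋-summand c p U k i x y)) (upTo n)
  Q₋-step c p U k used x y = begin
    Q₋ c p U (suc k) x y
      ≡⟨ cong₂ _-_ (Q-step c (+ p) U k x y) (Q-step c (- (+ p)) U k x y) ⟩
    (∑ _ (upTo n) + ∑ _ (upTo n)) - (∑ _ (upTo n) + ∑ _ (upTo n))
      ≡⟨ cong₂ _-_ (∑-+ _ _ (upTo n)) (∑-+ _ _ (upTo n)) ⟨
    ∑ _ (upTo n) - ∑ _ (upTo n)
      ≡⟨ ∑-minus _ _ (upTo n) ⟨
    ∑ _ (upTo n)
      ≡⟨ ∑-cong (upTo n) (λ i → paired i (available U i) (Used⇒≢ {U} used)) ⟩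
    ∑ (λ i → guard (available U i) (Q₋-summand c p U k i x y)) (upTo n) ∎
    where
    open ≡-Reasoning
    paired : ∀ i (avail : Bool) → (avail ≡ true → p ≢ suc i) →
      (guard avail (extend c (+ p) U k (+ suc i) x y) + guard avail (extend c (+ p) U k (- (+ suc i)) x y))
        - (guard avail (extend c (- (+ p)) U k (+ suc i) x y) + guard avail (extend c (- (+ p)) U k (- (+ suc i)) x y))
      ≡ guard avail (Q₋-summand c p U k i x y)
    paired i true p≢q = pairDiff c (variable-at c x y) p i _ _ (p≢q refl)
    paired i false p≢q = refl

  Q₊-HasGamma : ∀ {m h} c p U k → Used U p →
    (∀ i → HasGamma m h (Q₊-summand c p U k i)) → HasGamma m h (Q₊ c p U (suc k))
  Q₊-HasGamma c p U k used summand = HasGamma-resp (Q₊-step c p U k used)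
    (HasGamma-∑ (upTo n) (λ i x y → guard (available U i) (Q₊-summand c p U k i x y))
      (λ i → HasGamma-guard (available U i) (summand i)))

  Q₋-HasGamma : ∀ {m h} c p U k → Used U p →
    (∀ i → HasGamma m h (Q₋-summand c p U k i)) → HasGamma m h (Q₋ c p U (suc k))
  Q₋-HasGamma c p U k used summand = HasGamma-resp (Q₋-step c p U k used)
    (HasGamma-∑ (upTo n) (λ i x y → guard (available U i) (Q₋-summand c p U k i x y))
      (λ i → HasGamma-guard (available U i) (summand i)))

  one 1+x 1-x 1+y 1-y [1-y][1+x] [1-x][1+y] : ℤ → ℤ → ℤ
  one x y = + 1
  1+x x y = + 1 + x
  1-x x y = + 1 - x
  1+y x y = + 1 + y
  1-y x y = + 1 - y
  [1-y][1+x] x y = (+ 1 - y) * (+ 1 + x)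
  [1-x][1+y] x y = (+ 1 - x) * (+ 1 + y)

  -- The index is h where 2h or 2h + 1 letters remain; the subscript is the parity of the next position.
  Even₀ Odd₁ Even₁ Odd₀ : ℕ → Set
  Even₀ h = ∀ U p → Used U p →
    HasGamma one h (Q₊ true p U (double h)) × HasGamma⁻ [1-y][1+x] h (Q₋ true p U (double h))
  Odd₁ h = ∀ U p → Used U p →
    HasGamma 1+x h (Q₊ false p U (suc (double h))) × HasGamma 1-x h (Q₋ false p U (suc (double h)))
  Even₁ h = ∀ U p → Used U p →
    HasGamma one h (Q₊ false p U (double h)) × HasGamma⁻ [1-x][1+y] h (Q₋ false p U (double h))
  Odd₀ h = ∀ U p → Used U p →
    HasGamma 1+y h (Q₊ true p U (suc (double h))) × HasGamma 1-y h (Q₋ true p U (suc (double h)))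

  odd₁-from-even₀ : ∀ h → Even₀ h → Odd₁ h
  odd₁-from-even₀ h ih U p used =
      Q₊-HasGamma false p U (double h) used (λ i → HasGamma-+
        (HasGamma-scale 1+x 1+x (+ 1) sum-from-sum (proj₁ (next i)))
        (HasGamma⁻-[v-u] h (λ x y → + 1 * (+ 1 - x) * ⟦ not (below p i) ⟧) 1+x ⟦ not (below p i) ⟧
          (sum-from-diff ⟦ not (below p i) ⟧) (proj₂ (next i))))
    , Q₋-HasGamma false p U (double h) used (λ i →
        HasGamma-scale (λ x y → - (+ 1) * (+ 1 - x) * ⟦ below p i ⟧) 1-x (- (+ 1) * ⟦ below p i ⟧)
          (diff-from-sum ⟦ below p i ⟧) (proj₁ (next i)))
    where
    next : ∀ i → _
    next i = ih (suc i ∷ U) (suc i) (Used-new i U)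
    sum-from-sum : ∀ x y → (+ 1 + x) * + 1 ≡ + 1 * (+ 1 + x)
    sum-from-sum = solve-∀
    sum-from-diff : ∀ t x y → (+ 1 * (+ 1 - x) * t) * ((+ 1 - y) * (+ 1 + x)) ≡ t * ((+ 1 + x) * ((+ 1 + x * y) - (x + y)))
    sum-from-diff = solve-∀
    diff-from-sum : ∀ t x y → (- (+ 1) * (+ 1 - x) * t) * + 1 ≡ (- (+ 1) * t) * (+ 1 - x)
    diff-from-sum = solve-∀

  even₀-from-odd₁ : ∀ h → Odd₁ h → Even₀ (suc h)
  even₀-from-odd₁ h ih U p used =
      Q₊-HasGamma true p U (suc (double h)) used (λ i → HasGamma-+
        (HasGamma-[u+v] 1+y one (+ 1) sum-from-sum (proj₁ (next i)))
        (HasGamma-[v-u] (λ x y → e₀ * (+ 1 - y) * ⟦ not (below p i) ⟧) one (e₀ * ⟦ not (below p i) ⟧)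
          (sum-from-diff e₀ ⟦ not (below p i) ⟧) (proj₂ (next i))))
    , Q₋-HasGamma true p U (suc (double h)) used (λ i →
        HasGamma-scale (λ x y → - e₀ * (+ 1 - y) * ⟦ below p i ⟧) [1-y][1+x] (- e₀ * ⟦ below p i ⟧)
          (diff-from-sum e₀ ⟦ below p i ⟧) (proj₁ (next i)))
    where
    next : ∀ i → _
    next i = ih (suc i ∷ U) (suc i) (Used-new i U)
    sum-from-sum : ∀ x y → (+ 1 + y) * (+ 1 + x) ≡ + 1 * (+ 1 * ((x + y) + (+ 1 + x * y)))
    sum-from-sum = solve-∀
    sum-from-diff : ∀ e t x y → (e * (+ 1 - y) * t) * (+ 1 - x) ≡ (e * t) * (+ 1 * ((+ 1 + x * y) - (x + y)))
    sum-from-diff = solve-∀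
    diff-from-sum : ∀ e t x y → (- e * (+ 1 - y) * t) * (+ 1 + x) ≡ (- e * t) * ((+ 1 - y) * (+ 1 + x))
    diff-from-sum = solve-∀

  odd₀-from-even₁ : ∀ h → Even₁ h → Odd₀ h
  odd₀-from-even₁ h ih U p used =
      Q₊-HasGamma true p U (double h) used (λ i → HasGamma-+
        (HasGamma-scale 1+y 1+y (+ 1) sum-from-sum (proj₁ (next i)))
        (HasGamma⁻-[v-u] h (λ x y → e₀ * (+ 1 - y) * ⟦ not (below p i) ⟧) 1+y (e₀ * ⟦ not (below p i) ⟧)
          (sum-from-diff e₀ ⟦ not (below p i) ⟧) (proj₂ (next i))))
    , Q₋-HasGamma true p U (double h) used (λ i →
        HasGamma-scale (λ x y → - e₀ * (+ 1 - y) * ⟦ below p i ⟧) 1-y (- e₀ * ⟦ below p i ⟧)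
          (diff-from-sum e₀ ⟦ below p i ⟧) (proj₁ (next i)))
    where
    next : ∀ i → _
    next i = ih (suc i ∷ U) (suc i) (Used-new i U)
    sum-from-sum : ∀ x y → (+ 1 + y) * + 1 ≡ + 1 * (+ 1 + y)
    sum-from-sum = solve-∀
    sum-from-diff : ∀ e t x y →
      (e * (+ 1 - y) * t) * ((+ 1 - x) * (+ 1 + y)) ≡ (e * t) * ((+ 1 + y) * ((+ 1 + x * y) - (x + y)))
    sum-from-diff = solve-∀
    diff-from-sum : ∀ e t x y → (- e * (+ 1 - y) * t) * + 1 ≡ (- e * t) * (+ 1 - y)
    diff-from-sum = solve-∀

  even₁-from-odd₀ : ∀ h → Odd₀ h → Even₁ (suc h)
  even₁-from-odd₀ h ih U p used =
      Q₊-HasGamma false p U (suc (double h)) used (λ i → HasGamma-+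
        (HasGamma-[u+v] 1+x one (+ 1) sum-from-sum (proj₁ (next i)))
        (HasGamma-[v-u] (λ x y → + 1 * (+ 1 - x) * ⟦ not (below p i) ⟧) one ⟦ not (below p i) ⟧
          (sum-from-diff ⟦ not (below p i) ⟧) (proj₂ (next i))))
    , Q₋-HasGamma false p U (suc (double h)) used (λ i →
        HasGamma-scale (λ x y → - (+ 1) * (+ 1 - x) * ⟦ below p i ⟧) [1-x][1+y] (- (+ 1) * ⟦ below p i ⟧)
          (diff-from-sum ⟦ below p i ⟧) (proj₁ (next i)))
    where
    next : ∀ i → _
    next i = ih (suc i ∷ U) (suc i) (Used-new i U)
    sum-from-sum : ∀ x y → (+ 1 + x) * (+ 1 + y) ≡ + 1 * (+ 1 * ((x + y) + (+ 1 + x * y)))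
    sum-from-sum = solve-∀
    sum-from-diff : ∀ t x y → (+ 1 * (+ 1 - x) * t) * (+ 1 - y) ≡ t * (+ 1 * ((+ 1 + x * y) - (x + y)))
    sum-from-diff = solve-∀
    diff-from-sum : ∀ t x y → (- (+ 1) * (+ 1 - x) * t) * (+ 1 + y) ≡ (- (+ 1) * t) * ((+ 1 - x) * (+ 1 + y))
    diff-from-sum = solve-∀

  even₀ : ∀ h → Even₀ h
  even₀ zero U p used = hasGamma (λ _ → + 2) (λ x y → refl) , (λ x y → refl)
  even₀ (suc h) = even₀-from-odd₁ h (odd₁-from-even₀ h (even₀ h))

  even₁ : ∀ h → Even₁ h
  even₁ zero U p used = hasGamma (λ _ → + 2) (λ x y → refl) , (λ x y → refl)
  even₁ (suc h) = even₁-from-odd₀ h (odd₀-from-even₁ h (even₁ h))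

  odd₀ : ∀ h → Odd₀ h
  odd₀ h = odd₀-from-even₁ h (even₁ h)

-- Specialisation to signed permutations

words-length : ∀ (A : List ℤ) k → All (λ w → length w ≡ k) (words A k)
words-length A zero = refl ∷ []
words-length A (suc k) =
  All.concat⁺ (All.map⁺ (All.universal (λ a → All.map⁺ (All.map (cong suc) (words-length A k))) A))

countAlt-odd-bound : ∀ R a w → countAlt R false a w ℕ.+ countAlt R false a w ≤ length w
countAlt-even-bound : ∀ R a w → countAlt R true a w ℕ.+ countAlt R true a w ≤ suc (length w)
countAlt-odd-bound R a [] = z≤n
countAlt-odd-bound R a (b ∷ w) = countAlt-even-bound R b w
countAlt-even-bound R a [] = z≤n
countAlt-even-bound R a (b ∷ w) with R a b
... | true = s≤s (subst (_≤ suc (length w)) (sym (ℕₚ.+-suc _ _)) (s≤s (countAlt-odd-bound R b w)))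
... | false = ℕₚ.≤-trans (countAlt-odd-bound R b w) (ℕₚ.m≤n+m (length w) 2)

half-bound : ∀ h d → d ℕ.+ d ≤ suc (double h) → d ≤ h
half-bound h zero _ = z≤n
half-bound zero (suc d) (s≤s d+1+d≤0) rewrite ℕₚ.+-suc d d with d+1+d≤0
... | ()
half-bound (suc h) (suc d) (s≤s d+1+d≤) rewrite ℕₚ.+-suc d d with d+1+d≤
... | s≤s d+d≤ = s≤s (half-bound h d d+d≤)

des₁-bound : ∀ h n → n ≤ suc (double h) → All (λ σ → des₁ σ ≤ h) (signedPerms n)
des₁-bound h n n≤ = All.filter⁺ _ (All.map (λ {σ} length≡n → half-bound h (des₁ σ)
  (ℕₚ.≤-trans (subst (des₁ σ ℕ.+ des₁ σ ≤_) length≡n (countAlt-odd-bound _>ᵇ_ (+ 0) σ)) n≤))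
  (words-length (signedVals n) n))

double-/2 : ∀ h → double h ℕ./ 2 ≡ h
double-/2 zero = refl
double-/2 (suc h) = trans (m/n≡1+[m∸n]/n {double (suc h)} {2} (s≤s (s≤s z≤n))) (cong suc (double-/2 h))

suc-double-/2 : ∀ h → suc (double h) ℕ./ 2 ≡ h
suc-double-/2 zero = refl
suc-double-/2 (suc h) = trans (m/n≡1+[m∸n]/n {suc (double (suc h))} {2} (s≤s (s≤s z≤n))) (cong suc (suc-double-/2 h))

2*≡double : ∀ m → 2 ℕ.* m ≡ double m
2*≡double zero = refl
2*≡double (suc m) = cong suc (trans (ℕₚ.+-suc m (m ℕ.+ 0)) (cong suc (2*≡double m)))

Γ≡gammaSum : ∀ (c : ℕ → ℕ → ℕ) n h → n ℕ./ 2 ≡ h → ∀ x y → Γ h (λ j → + c n j) x y ≡ gammaSum c n x y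
Γ≡gammaSum c n _ refl x y = Γ-explicit (n ℕ./ 2) (λ j → + c n j) x y

module Specialisation (R₀ : ℤ → ℤ → Bool) (e₀ : ℤ)
  (pairSum₀ : PairSum R₀ e₀) (pairDiff₀ : PairDiff R₀ e₀) where

  stat₀ : List ℤ → ℕ
  stat₀ σ = countAlt R₀ true (+ 0) σ

  B : ℕ → ℤ → ℤ → ℤ
  B n x y = ∑ (λ σ → x ^ des₁ σ * y ^ stat₀ σ) (signedPerms n)

  b : ℕ → ℕ → ℕ
  b n j = length (filter (λ σ → ((des₁ σ ≡ᵇ j) ∧ (stat₀ σ ≡ᵇ 0)) Bool.≟ true) (signedPerms n))

  module _ (n : ℕ) where

    open GammaInvariants R₀ e₀ pairSum₀ pairDiff₀ n

    B≡Q : ∀ x y → B n x y ≡ Q true (+ 0) [] n x y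
    B≡Q x y = trans (∑-filter (λ w → distinctᵇ (map ∣_∣ w)) _ (words (signedVals n) n))
      (∑-cong (words (signedVals n) n) signed-permutation)
      where
      signed-permutation : ∀ w → guard (distinctᵇ (map ∣_∣ w)) (x ^ des₁ w * y ^ stat₀ w)
        ≡ guard (freshᵇ [] w) (wordWeight true (+ 0) w x y)
      signed-permutation w rewrite disjointᵇ-[] (map ∣_∣ w) | ∧-identityʳ (distinctᵇ (map ∣_∣ w))
        with distinctᵇ (map ∣_∣ w)
      ... | true = monomial≡wordWeight true (+ 0) w x y
      ... | false = refl

    -- σ(0) = 0 = -σ(0), so the pair sum at p = 0 counts every signed permutation twice.
    B+B≡Q₊ : ∀ x y → B n x y + B n x y ≡ Q₊ true 0 [] n x y
    B+B≡Q₊ x y = cong₂ _+_ (B≡Q x y) (B≡Q x y)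

  B-at-y≡0 : ∀ h n → n ≤ suc (double h) → ∀ x → B n x (+ 0) ≡ Pol h (λ j → + b n j) x
  B-at-y≡0 h n n≤ x = sym (begin
    Pol h (λ j → + b n j) x
      ≡⟨ Pol-cong h (λ j → length-filter (λ σ → (des₁ σ ≡ᵇ j) ∧ (stat₀ σ ≡ᵇ 0)) (signedPerms n)) x ⟩
    Pol h (λ j → ∑ (λ σ → ⟦ (des₁ σ ≡ᵇ j) ∧ (stat₀ σ ≡ᵇ 0) ⟧) (signedPerms n)) x
      ≡⟨ Pol-∑ h (λ σ j → ⟦ (des₁ σ ≡ᵇ j) ∧ (stat₀ σ ≡ᵇ 0) ⟧) (signedPerms n) x ⟩
    ∑ (λ σ → Pol h (λ j → ⟦ (des₁ σ ≡ᵇ j) ∧ (stat₀ σ ≡ᵇ 0) ⟧) x) (signedPerms n)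
      ≡⟨ ∑-cong-All (All.map (λ {σ} des₁≤h → trans (Pol-indicator h (des₁ σ) (stat₀ σ ≡ᵇ 0) x des₁≤h)
                                                  (sym (*-0^ (x ^ des₁ σ) (stat₀ σ))))
                             (des₁-bound h n n≤)) ⟩
    B n x (+ 0) ∎)
    where
    open ≡-Reasoning
    *-0^ : ∀ a d → a * (+ 0) ^ d ≡ guard (d ≡ᵇ 0) a
    *-0^ a zero = ℤₚ.*-identityʳ a
    *-0^ a (suc d) = ℤₚ.*-zeroʳ a

  B-even : ∀ h x y → B (double h) x y ≡ Γ h (λ j → + b (double h) j) x y
  B-even h x y = trans
    (Γ-coeff-from-y≡0 h (B (double h)) (λ _ _ → + 1) (λ j → + b (double h) j) (coeff Q₊∈Γ) (λ _ → refl)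
      (B-at-y≡0 h (double h) (ℕₚ.n≤1+n _)) (λ x y → trans (B+B≡Q₊ (double h) x y) (expand Q₊∈Γ x y)) x y)
    (ℤₚ.*-identityˡ _)
    where
    open GammaInvariants R₀ e₀ pairSum₀ pairDiff₀ (double h)
    Q₊∈Γ : HasGamma one h (Q₊ true 0 [] (double h))
    Q₊∈Γ = proj₁ (even₀ h [] 0 (inj₁ refl))

  B-odd : ∀ h x y → B (suc (double h)) x y ≡ (+ 1 + y) * Γ h (λ j → + b (suc (double h)) j) x y
  B-odd h = Γ-coeff-from-y≡0 h (B (suc (double h))) (λ _ y → + 1 + y) (λ j → + b (suc (double h)) j)
    (coeff Q₊∈Γ) (λ _ → refl) (B-at-y≡0 h (suc (double h)) ℕₚ.≤-refl)
    (λ x y → trans (B+B≡Q₊ (suc (double h)) x y) (expand Q₊∈Γ x y))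
    where
    open GammaInvariants R₀ e₀ pairSum₀ pairDiff₀ (suc (double h))
    Q₊∈Γ : HasGamma 1+y h (Q₊ true 0 [] (suc (double h)))
    Q₊∈Γ = proj₁ (odd₀ h [] 0 (inj₁ refl))

  B-gammaSum-even : ∀ m x y → B (2 ℕ.* m) x y ≡ gammaSum b (2 ℕ.* m) x y
  B-gammaSum-even m x y = subst (λ n → B n x y ≡ gammaSum b n x y) (sym (2*≡double m))
    (trans (B-even m x y) (Γ≡gammaSum b (double m) m (double-/2 m) x y))

  B-gammaSum-odd : ∀ m → 1 ≤ m → ∀ x y → B (2 ℕ.* m ∸ 1) x y ≡ (+ 1 + y) * gammaSum b (2 ℕ.* m ∸ 1) x y
  B-gammaSum-odd (suc m) _ x y = subst (λ n → B n x y ≡ (+ 1 + y) * gammaSum b n x y)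
    (sym (cong (_∸ 1) (2*≡double (suc m))))
    (trans (B-odd m x y) (cong ((+ 1 + y) *_) (Γ≡gammaSum b (suc (double m)) m (suc-double-/2 m) x y)))

module Descents = Specialisation _>ᵇ_ (+ 1) pairSum-descent pairDiff-descent
module Ascents = Specialisation _<ᵇ_ (- (+ 1)) pairSum-ascent pairDiff-ascent

theorem2p10 :
    ((m : ℕ) → 1 ≤ m → (x y : ℤ) →
        Bpoly (2 Data.Nat.* m) x y ≡ gammaSum bcoef (2 Data.Nat.* m) x y)
    × ((m : ℕ) → 1 ≤ m → (x y : ℤ) →
        Bpoly (2 Data.Nat.* m ∸ 1) x y ≡ (+ 1 + y) * gammaSum bcoef (2 Data.Nat.* m ∸ 1) x y)
    × ((m : ℕ) → 1 ≤ m → (x y : ℤ) →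
        Bhat (2 Data.Nat.* m) x y ≡ gammaSum bbarcoef (2 Data.Nat.* m) x y)
    × ((m : ℕ) → 1 ≤ m → (x y : ℤ) →
        Bhat (2 Data.Nat.* m ∸ 1) x y ≡ (+ 1 + y) * gammaSum bbarcoef (2 Data.Nat.* m ∸ 1) x y)
theorem2p10 =
    (λ m _ → Descents.B-gammaSum-even m)
  , Descents.B-gammaSum-odd
  , (λ m _ → Ascents.B-gammaSum-even m)
  , Ascents.B-gammaSum-odd
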